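{- Let $G$ and $H$ be connected graphs, each of order at least $2$. Then $\dim_s(G\Box H)=2$ if and only if $G$ and $H$ are both paths.
   Context: All graphs are finite and simple. For a connected graph $G$, $I_G[u,v]$ is the set of vertices on some shortest $u$–$v$ path. A vertex $w$ strongly resolves $u,v$ if $v\in I_G[u,w]$ or $u\in I_G[v,w]$. A strong resolving set is a set $S\subseteq V(G)$ such that every pair of vertices is strongly resolved by some vertex of $S$; $\dim_s(G)$ is the minimum cardinality of a strong resolving set. $G\Box H$ is the Cartesian product: vertex set $V(G)\times V(H)$, $(a,b)\sim(c,d)$ iff ($a=c$ and $bd\in E(H)$) or ($b=d$ and $ac\in E(G)$). -}

module Defs where

open import Data.Nat using (ℕ; zero; suc; _+_; _*_; _≤_)
open import Data.Fin using (Fin; toℕ; remQuot)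
open import Data.Fin.Subset using (Subset; _∈_; ∣_∣)
open import Data.Product using (Σ; _×_; _,_; ∃; proj₁; proj₂)
open import Data.Sum using (_⊎_)
open import Relation.Binary.PropositionalEquality using (_≡_; _≢_)
open import Relation.Nullary using (¬_)
open import Function.Definitions using (Bijective)
open import Function.Bundles using (_⇔_)

AdjRel : ℕ → Set₁
AdjRel n = Fin n → Fin n → Set

record Graph : Set₁ where
  field
    n      : ℕ
    Adj    : AdjRel n
    sym    : ∀ {u v} → Adj u v → Adj v u
    irrefl : ∀ {u} → ¬ Adj u u
open Graph public

data Walk {n : ℕ} (A : AdjRel n) : Fin n → Fin n → ℕ → Set where
  []  : ∀ {u} → Walk A u u 0
  _∷_ : ∀ {u v w k} → A u v → Walk A v w k → Walk A u w (suc k)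

data OnWalk {n : ℕ} {A : AdjRel n} (x : Fin n) : ∀ {u w k} → Walk A u w k → Set where
  here  : ∀ {w k} {p : Walk A x w k} → OnWalk x p
  there : ∀ {u v w k} {e : A u v} {p : Walk A v w k} → OnWalk x p → OnWalk x (e ∷ p)

IsShortest : ∀ {n} {A : AdjRel n} {u v k} → Walk A u v k → Set
IsShortest {A = A} {u} {v} {k} _ = ∀ k' → Walk A u v k' → k ≤ k'

InInterval : ∀ {n} → AdjRel n → Fin n → Fin n → Fin n → Set
InInterval A u v w = Σ ℕ λ k → Σ (Walk A u v k) λ p → IsShortest p × OnWalk w p

Connected : ∀ {n} → AdjRel n → Set
Connected A = ∀ u v → ∃ λ k → Walk A u v k

StronglyResolves : ∀ {n} → AdjRel n → Fin n → Fin n → Fin n → Set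
StronglyResolves A w u v = InInterval A u w v ⊎ InInterval A v w u

IsStrongResolvingSet : ∀ {n} → AdjRel n → Subset n → Set
IsStrongResolvingSet {n} A S =
  ∀ (u v : Fin n) → u ≢ v → Σ (Fin n) λ w → w ∈ S × StronglyResolves A w u v

StrongMetricDimIs : ∀ {n} → AdjRel n → ℕ → Set
StrongMetricDimIs {n} A d =
  (Σ (Subset n) λ S → IsStrongResolvingSet A S × ∣ S ∣ ≡ d)
  × (∀ (S : Subset n) → IsStrongResolvingSet A S → d ≤ ∣ S ∣)

Box : (G H : Graph) → AdjRel (n G * n H)
Box G H x y =
  let (a , b) = remQuot {n G} (n H) x
      (c , d) = remQuot {n G} (n H) y
  in (a ≡ c × Adj H b d) ⊎ (b ≡ d × Adj G a c)

PathAdj : (m : ℕ) → AdjRel m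
PathAdj m i j = suc (toℕ i) ≡ toℕ j ⊎ suc (toℕ j) ≡ toℕ i

IsPath : Graph → Set
IsPath G = Σ (Fin (n G) → Fin (n G)) λ f →
  Bijective _≡_ _≡_ f × (∀ u v → Adj G u v ⇔ PathAdj (n G) (f u) (f v))

-- If a single vertex c strongly resolves a graph, then the distance to c is injective,
-- its values form an initial segment of ℕ, and adjacent vertices lie at consecutive
-- distances: the graph is a path. In G □ H geodesic intervals split coordinatewise.
-- The two vertices of a strong resolving set {w₁, w₂} cannot differ in both
-- coordinates, since then neither resolves the crossed pair (a₂,b₁), (a₁,b₂). If they
-- share the G-coordinate a, then a strongly resolves G, and every ordered pair of H lies
-- on a geodesic towards b₁ or b₂, which forces b₁ alone to resolve H. The crossed pair
-- also shows that one vertex never suffices. Conversely, when G and H are paths the grid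
-- distance is the ℓ₁ distance of coordinates, and two corners sharing the G-coordinate 0
-- resolve every pair.
module Submission where

open import Data.Empty using (⊥-elim)
open import Data.Fin as Fin using (Fin; toℕ; fromℕ<; combine; remQuot)
import Data.Fin.Properties as Finₚ
open import Data.Fin.Subset as Subset using (Subset; _∈_; ∣_∣; ⁅_⁆; _∪_)
open import Data.Fin.Subset.Properties
  using (nonempty?; x∈p⇒∣p-x∣<∣p∣; x∈p∧x≢y⇒x∈p-y; ∪-identityˡ; ∪-identityʳ; ∣⁅x⁆∣≡1; x∈⁅x⁆; x∈p∪q⁺)
open import Data.Nat
  using (ℕ; zero; suc; _+_; _*_; pred; _≤_; _<_; z≤n; s≤s; s≤s⁻¹; _≤?_; ∣_-_∣; >-nonZero)
open import Data.Nat.Properties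
open import Algebra.Properties.CommutativeSemigroup +-commutativeSemigroup using (interchange)
open import Data.Product as Σ using (Σ; _×_; _,_; proj₁; proj₂)
open import Data.Sum as Sum using (_⊎_; inj₁; inj₂)
open import Function.Base using (_∘_; flip; case_of_)
open import Function.Bundles using (_⇔_; Equivalence; mk⇔)
open import Function.Definitions using (Surjective)
open import Relation.Binary.Definitions using (tri<; tri≈; tri>)
open import Relation.Binary.PropositionalEquality
open import Relation.Nullary using (¬_; yes; no; contradiction)
open import Relation.Nullary.Decidable using (decidable-stable)

open import Defs hiding (sym)

m≤n≤o⇒∣m-n∣+∣n-o∣≡∣m-o∣ : ∀ {m n o} → m ≤ n → n ≤ o → ∣ m - n ∣ + ∣ n - o ∣ ≡ ∣ m - o ∣
m≤n≤o⇒∣m-n∣+∣n-o∣≡∣m-o∣ {m} m≤n n≤o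
  with p , refl ← m≤n⇒∃[o]m+o≡n m≤n | q , refl ← m≤n⇒∃[o]m+o≡n n≤o = begin
    ∣ m - m + p ∣ + ∣ m + p - m + p + q ∣ ≡⟨ cong₂ _+_ (∣m-m+n∣≡n m p) (∣m-m+n∣≡n (m + p) q) ⟩
    p + q                                 ≡⟨ sym (∣m-m+n∣≡n m (p + q)) ⟩
    ∣ m - m + (p + q) ∣                   ≡⟨ cong (λ k → ∣ m - k ∣) (sym (+-assoc m p q)) ⟩
    ∣ m - m + p + q ∣                     ∎
  where open ≡-Reasoning

o≤n≤m⇒∣m-n∣+∣n-o∣≡∣m-o∣ : ∀ {m n o} → o ≤ n → n ≤ m → ∣ m - n ∣ + ∣ n - o ∣ ≡ ∣ m - o ∣
o≤n≤m⇒∣m-n∣+∣n-o∣≡∣m-o∣ {m} {n} {o} o≤n n≤m = begin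
  ∣ m - n ∣ + ∣ n - o ∣ ≡⟨ cong₂ _+_ (∣-∣-comm m n) (∣-∣-comm n o) ⟩
  ∣ n - m ∣ + ∣ o - n ∣ ≡⟨ +-comm ∣ n - m ∣ ∣ o - n ∣ ⟩
  ∣ o - n ∣ + ∣ n - m ∣ ≡⟨ m≤n≤o⇒∣m-n∣+∣n-o∣≡∣m-o∣ o≤n n≤m ⟩
  ∣ o - m ∣             ≡⟨ ∣-∣-comm o m ⟩
  ∣ m - o ∣             ∎
  where open ≡-Reasoning

∣n-suc-n∣≡1 : ∀ n → ∣ n - suc n ∣ ≡ 1
∣n-suc-n∣≡1 zero    = refl
∣n-suc-n∣≡1 (suc n) = ∣n-suc-n∣≡1 n

aVertex : ∀ {N} → 2 ≤ N → Fin N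
aVertex (s≤s _) = Fin.zero

anotherVertex : ∀ {N} → 2 ≤ N → (i : Fin N) → Σ (Fin N) λ j → j ≢ i
anotherVertex (s≤s (s≤s _)) i = Fin.punchIn i Fin.zero , Finₚ.punchInᵢ≢i i Fin.zero

module _ {N : ℕ} where

  x∈p⇒0<∣p∣ : ∀ {p : Subset N} {x} → x ∈ p → 0 < ∣ p ∣
  x∈p⇒0<∣p∣ x∈p = ≤-<-trans z≤n (x∈p⇒∣p-x∣<∣p∣ x∈p)

  ∣p∣≤1⇒∈-unique : ∀ {p : Subset N} → ∣ p ∣ ≤ 1 → ∀ {x y} → x ∈ p → y ∈ p → x ≡ y
  ∣p∣≤1⇒∈-unique {p} ∣p∣≤1 {x} {y} x∈p y∈p = decidable-stable (x Finₚ.≟ y) λ x≢y →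
    <-irrefl refl (begin-strict
      1                ≤⟨ x∈p⇒0<∣p∣ (x∈p∧x≢y⇒x∈p-y y∈p (≢-sym x≢y)) ⟩
      ∣ p Subset.- x ∣ <⟨ x∈p⇒∣p-x∣<∣p∣ x∈p ⟩
      ∣ p ∣            ≤⟨ ∣p∣≤1 ⟩
      1                ∎)
    where open ≤-Reasoning

  ∣p∣≤2⇒⊆pair : ∀ {p : Subset N} → ∣ p ∣ ≤ 2 → ∀ {x} → x ∈ p →
                Σ (Fin N) λ y → ∀ {z} → z ∈ p → z ≡ x ⊎ z ≡ y
  ∣p∣≤2⇒⊆pair {p} ∣p∣≤2 {x} x∈p with nonempty? (p Subset.- x)
  ... | yes (y , y∈p-x) = y , λ {z} z∈p → case z Finₚ.≟ x of λ where
          (yes z≡x) → inj₁ z≡x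
          (no z≢x)  → inj₂ (∣p∣≤1⇒∈-unique ∣p-x∣≤1 (x∈p∧x≢y⇒x∈p-y z∈p z≢x) y∈p-x)
    where
      ∣p-x∣≤1 : ∣ p Subset.- x ∣ ≤ 1
      ∣p-x∣≤1 = s≤s⁻¹ (<-≤-trans (x∈p⇒∣p-x∣<∣p∣ x∈p) ∣p∣≤2)
  ... | no p-x-empty = x , λ {z} z∈p → inj₁ (decidable-stable (z Finₚ.≟ x) λ z≢x →
          p-x-empty (z , x∈p∧x≢y⇒x∈p-y z∈p z≢x))

∣⁅x⁆∪⁅y⁆∣≡2 : ∀ {N} {x y : Fin N} → x ≢ y → ∣ ⁅ x ⁆ ∪ ⁅ y ⁆ ∣ ≡ 2
∣⁅x⁆∪⁅y⁆∣≡2 {x = Fin.zero}  {Fin.zero}  x≢y = contradiction refl x≢y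
∣⁅x⁆∪⁅y⁆∣≡2 {x = Fin.zero}  {Fin.suc y} _   = cong suc (trans (cong ∣_∣ (∪-identityˡ ⁅ y ⁆)) (∣⁅x⁆∣≡1 y))
∣⁅x⁆∪⁅y⁆∣≡2 {x = Fin.suc x} {Fin.zero}  _   = cong suc (trans (cong ∣_∣ (∪-identityʳ ⁅ x ⁆)) (∣⁅x⁆∣≡1 x))
∣⁅x⁆∪⁅y⁆∣≡2 {x = Fin.suc x} {Fin.suc y} x≢y = ∣⁅x⁆∪⁅y⁆∣≡2 (λ x≡y → x≢y (cong Fin.suc x≡y))

-- z ∈ I[x,y] in metric form: d(x,z) + d(z,y) ≤ d(x,y), witnessed by walks.
record Between {N : ℕ} (A : AdjRel N) (x y z : Fin N) : Set where
  constructor between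
  field
    {k₁ k₂}  : ℕ
    toMid    : Walk A x z k₁
    fromMid  : Walk A z y k₂
    geodesic : ∀ {m} → Walk A x y m → k₁ + k₂ ≤ m

module _ {N : ℕ} {A : AdjRel N} where

  infixr 5 _++_
  _++_ : ∀ {u v w k l} → Walk A u v k → Walk A v w l → Walk A u w (k + l)
  []      ++ q = q
  (e ∷ p) ++ q = e ∷ (p ++ q)

  onWalk-++ : ∀ {u v w k l} (p : Walk A u v k) (q : Walk A v w l) → OnWalk v (p ++ q)
  onWalk-++ []      q = here
  onWalk-++ (e ∷ p) q = there (onWalk-++ p q)

  splitAt : ∀ {x u w k} {p : Walk A u w k} → OnWalk x p →
            Σ ℕ λ k₁ → Σ ℕ λ k₂ → Walk A u x k₁ × Walk A x w k₂ × k₁ + k₂ ≡ k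
  splitAt {p = p} here = 0 , _ , [] , p , refl
  splitAt {p = e ∷ p} (there x∈p) with splitAt x∈p
  ... | k₁ , k₂ , p₁ , p₂ , eq = suc k₁ , k₂ , e ∷ p₁ , p₂ , cong suc eq

  walk≤0⇒≡ : ∀ {u v k} → Walk A u v k → k ≤ 0 → u ≡ v
  walk≤0⇒≡ [] _ = refl

  interval⇒between : ∀ {x y z} → InInterval A x y z → Between A x y z
  interval⇒between (_ , _ , shortest , z∈p) with splitAt z∈p
  ... | _ , _ , p₁ , p₂ , refl = between p₁ p₂ (shortest _)

  between⇒interval : ∀ {x y z} → Between A x y z → InInterval A x y z
  between⇒interval (between p q geodesic) = _ , p ++ q , (λ _ → geodesic) , onWalk-++ p q

  between-self : ∀ {x z} → Between A x x z → z ≡ x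
  between-self (between p _ geodesic) = sym (walk≤0⇒≡ p (m+n≤o⇒m≤o _ (geodesic [])))

  interval-self : ∀ {x z} → InInterval A x x z → z ≡ x
  interval-self = between-self ∘ interval⇒between

  between-antisym : ∀ {x y z} → Between A x z y → Between A y z x → x ≡ y
  between-antisym (between {k₁} {k₂} p q geo) (between {l₁} {l₂} _ q′ geo′) =
    walk≤0⇒≡ p (+-cancelʳ-≤ k₂ k₁ 0 (begin
      k₁ + k₂ ≤⟨ geo q′ ⟩
      l₂      ≤⟨ m≤n+m l₂ l₁ ⟩
      l₁ + l₂ ≤⟨ geo′ q ⟩
      k₂      ∎))
    where open ≤-Reasoning

  twoCentres⇒resolves : ∀ {c c′} → (∀ x y → x ≢ y → InInterval A y c x ⊎ InInterval A y c′ x) →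
                        ∀ x y → x ≢ y → StronglyResolves A c x y
  twoCentres⇒resolves cover x y x≢y with cover x y x≢y | cover y x (≢-sym x≢y)
  ... | inj₁ x∈I[y,c]  | _              = inj₂ x∈I[y,c]
  ... | inj₂ _         | inj₁ y∈I[x,c]  = inj₁ y∈I[x,c]
  ... | inj₂ x∈I[y,c′] | inj₂ y∈I[x,c′] =
    contradiction (between-antisym (interval⇒between y∈I[x,c′]) (interval⇒between x∈I[y,c′])) x≢y

reverse : (G : Graph) → ∀ {u v k} → Walk (Adj G) u v k → Walk (Adj G) v u k
reverse G []                = []
reverse G {k = suc k} (e ∷ p) =
  subst (Walk (Adj G) _ _) (+-comm k 1) (reverse G p ++ (Graph.sym G e ∷ []))

module SingleStrongResolver (G : Graph) (c : Fin (n G))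
         (resolves : ∀ x y → x ≢ y → StronglyResolves (Adj G) c x y) where

  private
    A = Adj G
    N = n G

  geodesicToCentre : ∀ x → Σ ℕ λ k → Walk A x c k × (∀ {m} → Walk A x c m → k ≤ m)
  geodesicToCentre x with x Finₚ.≟ c
  ... | yes refl = 0 , [] , λ _ → z≤n
  ... | no x≢c with resolves x c x≢c
  ... | inj₁ (k , p , shortest , _) = k , p , shortest _
  ... | inj₂ x∈I[c,c] = contradiction (between-self (interval⇒between x∈I[c,c])) x≢c

  dist : Fin N → ℕ
  dist x = proj₁ (geodesicToCentre x)

  dist-walk : ∀ x → Walk A x c (dist x)
  dist-walk x = proj₁ (proj₂ (geodesicToCentre x))

  dist-minimal : ∀ {x m} → Walk A x c m → dist x ≤ m
  dist-minimal {x} = proj₂ (proj₂ (geodesicToCentre x))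

  dist-edge : ∀ {x y} → A x y → dist x ≤ suc (dist y)
  dist-edge e = dist-minimal (e ∷ dist-walk _)

  dist-between : ∀ {x y} → x ≢ y → Between A x c y → dist y < dist x
  dist-between x≢y (between [] _ _) = contradiction refl x≢y
  dist-between {x} {y} x≢y (between {suc k₁} {k₂} (_ ∷ _) q geo) = begin-strict
    dist y      ≤⟨ dist-minimal q ⟩
    k₂          <⟨ s≤s (m≤n+m k₂ k₁) ⟩
    suc k₁ + k₂ ≤⟨ geo (dist-walk x) ⟩
    dist x      ∎
    where open ≤-Reasoning

  dist-injective : ∀ {x y} → dist x ≡ dist y → x ≡ y
  dist-injective {x} {y} eq with x Finₚ.≟ y
  ... | yes x≡y = x≡y
  ... | no x≢y with resolves x y x≢y
  ... | inj₁ y∈I[x,c] = contradiction (sym eq) (<⇒≢ (dist-between x≢y (interval⇒between y∈I[x,c])))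
  ... | inj₂ x∈I[y,c] = contradiction eq (<⇒≢ (dist-between (≢-sym x≢y) (interval⇒between x∈I[y,c])))

  dist-pred : ∀ x {k} → dist x ≡ suc k → Σ (Fin N) λ z → A x z × dist z ≡ k
  dist-pred x {k} eq = step (subst (Walk A x c) eq (dist-walk x))
    where
      step : Walk A x c (suc k) → Σ (Fin N) λ z → A x z × dist z ≡ k
      step (e ∷ q) = _ , e , ≤-antisym (dist-minimal q)
                               (s≤s⁻¹ (subst (_≤ suc _) eq (dist-edge e)))

  dist-downClosed : ∀ m x → dist x ≡ m → ∀ {j} → j ≤ m → Σ (Fin N) λ z → dist z ≡ j
  dist-downClosed zero    x eq z≤n = x , eq
  dist-downClosed (suc m) x eq j≤1+m with m≤n⇒m<n∨m≡n j≤1+m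
  ... | inj₂ refl = x , eq
  ... | inj₁ j<1+m with dist-pred x eq
  ... | z , _ , dist-z≡m = dist-downClosed m z dist-z≡m (s≤s⁻¹ j<1+m)

  dist<n : ∀ x → dist x < N
  dist<n x = Finₚ.injective⇒≤ vertexAt-injective
    where
      vertexAt : Fin (suc (dist x)) → Fin N
      vertexAt j = proj₁ (dist-downClosed _ x refl (s≤s⁻¹ (Finₚ.toℕ<n j)))
      dist-vertexAt : ∀ j → dist (vertexAt j) ≡ toℕ j
      dist-vertexAt j = proj₂ (dist-downClosed _ x refl (s≤s⁻¹ (Finₚ.toℕ<n j)))
      vertexAt-injective : ∀ {i j} → vertexAt i ≡ vertexAt j → i ≡ j
      vertexAt-injective {i} {j} eq = Finₚ.toℕ-injective
        (trans (sym (dist-vertexAt i)) (trans (cong dist eq) (dist-vertexAt j)))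

  position : Fin N → Fin N
  position x = fromℕ< (dist<n x)

  toℕ-position : ∀ x → toℕ (position x) ≡ dist x
  toℕ-position x = Finₚ.toℕ-fromℕ< (dist<n x)

  position-injective : ∀ {x y} → position x ≡ position y → x ≡ y
  position-injective {x} {y} eq =
    dist-injective (trans (sym (toℕ-position x)) (trans (cong toℕ eq) (toℕ-position y)))

  position-surjective : Surjective _≡_ _≡_ position
  position-surjective i with Finₚ.injective⇒existsPivot position-injective i
  ... | x , _ , i≤position-x
    with dist-downClosed _ x refl (subst (toℕ i ≤_) (toℕ-position x) i≤position-x)
  ... | z , dist-z≡i = z , λ { refl → Finₚ.toℕ-injective (trans (toℕ-position z) dist-z≡i) }

  DistAdjacent : Fin N → Fin N → Set
  DistAdjacent x y = suc (dist x) ≡ dist y ⊎ suc (dist y) ≡ dist x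

  adjacent⇒distAdjacent : ∀ {x y} → A x y → DistAdjacent x y
  adjacent⇒distAdjacent {x} {y} e with <-cmp (dist x) (dist y)
  ... | tri< lt _ _ = inj₁ (≤-antisym lt (dist-edge (Graph.sym G e)))
  ... | tri≈ _ eq _ = contradiction (subst (A x) (sym (dist-injective eq)) e) (Graph.irrefl G)
  ... | tri> _ _ gt = inj₂ (≤-antisym gt (dist-edge e))

  distAdjacent⇒adjacent : ∀ {x y} → DistAdjacent x y → A x y
  distAdjacent⇒adjacent {x} {y} (inj₁ eq) with dist-pred y (sym eq)
  ... | z , y~z , dist-z≡dist-x = Graph.sym G (subst (A y) (dist-injective dist-z≡dist-x) y~z)
  distAdjacent⇒adjacent {x} {y} (inj₂ eq) with dist-pred x (sym eq)
  ... | z , x~z , dist-z≡dist-y = subst (A x) (dist-injective dist-z≡dist-y) x~z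

  adjacent⇔pathAdj : ∀ x y → A x y ⇔ PathAdj N (position x) (position y)
  adjacent⇔pathAdj x y rewrite toℕ-position x | toℕ-position y =
    mk⇔ adjacent⇒distAdjacent distAdjacent⇒adjacent

  isPath : IsPath G
  isPath = position , (position-injective , position-surjective) , adjacent⇔pathAdj

module PathCoordinate (G : Graph) (P : IsPath G) where

  private
    A = Adj G
    N = n G
    f = proj₁ P
    f-injective = proj₁ (proj₁ (proj₂ P))
    f-surjective = proj₂ (proj₁ (proj₂ P))
    f-adjacency = proj₂ (proj₂ P)

  coord : Fin N → ℕ
  coord x = toℕ (f x)

  vertexAt : ∀ {i} → i < N → Σ (Fin N) λ x → coord x ≡ i
  vertexAt i<N = proj₁ (f-surjective (fromℕ< i<N)) ,
    trans (cong toℕ (proj₂ (f-surjective (fromℕ< i<N)) refl)) (Finₚ.toℕ-fromℕ< i<N)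

  edge-coord : ∀ {x y} → A x y → ∣ coord x - coord y ∣ ≡ 1
  edge-coord {x} {y} e with Equivalence.to (f-adjacency x y) e
  ... | inj₁ eq = subst (λ j → ∣ coord x - j ∣ ≡ 1) eq (∣n-suc-n∣≡1 (coord x))
  ... | inj₂ eq = subst (λ i → ∣ i - coord y ∣ ≡ 1) eq
                    (trans (∣-∣-comm (suc (coord y)) (coord y)) (∣n-suc-n∣≡1 (coord y)))

  walk-coord : ∀ {x y k} → Walk A x y k → ∣ coord x - coord y ∣ ≤ k
  walk-coord {x} []                = ≤-reflexive (∣n-n∣≡0 (coord x))
  walk-coord {x} {y} (_∷_ {v = z} e p) = begin
    ∣ coord x - coord y ∣                         ≤⟨ ∣-∣-triangle (coord x) (coord z) (coord y) ⟩
    ∣ coord x - coord z ∣ + ∣ coord z - coord y ∣ ≤⟨ +-mono-≤ (≤-reflexive (edge-coord e)) (walk-coord p) ⟩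
    suc _                                         ∎
    where open ≤-Reasoning

  ascendingWalk : ∀ k x y → coord x + k ≡ coord y → Walk A x y k
  ascendingWalk zero x y eq = subst (λ z → Walk A x z 0) x≡y []
    where
      x≡y : x ≡ y
      x≡y = f-injective (Finₚ.toℕ-injective (trans (sym (+-identityʳ (coord x))) eq))
  ascendingWalk (suc k) x y eq = x~x⁺ ∷ ascendingWalk k x⁺ y (trans (cong (_+ k) coord-x⁺) eq′)
    where
      eq′ : suc (coord x) + k ≡ coord y
      eq′ = trans (sym (+-suc (coord x) k)) eq
      x⁺<N : suc (coord x) < N
      x⁺<N = ≤-<-trans (≤-trans (m≤m+n (suc (coord x)) k) (≤-reflexive eq′)) (Finₚ.toℕ<n (f y))
      x⁺ = proj₁ (vertexAt x⁺<N)
      coord-x⁺ : coord x⁺ ≡ suc (coord x)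
      coord-x⁺ = proj₂ (vertexAt x⁺<N)
      x~x⁺ : A x x⁺
      x~x⁺ = Equivalence.from (f-adjacency x x⁺) (inj₁ (sym coord-x⁺))

  coordWalk : ∀ x y → Walk A x y ∣ coord x - coord y ∣
  coordWalk x y with ≤-total (coord x) (coord y)
  ... | inj₁ x≤y = subst (Walk A x y) (sym (m≤n⇒∣m-n∣≡n∸m x≤y))
                     (ascendingWalk _ x y (m+[n∸m]≡n x≤y))
  ... | inj₂ y≤x = subst (Walk A x y) (sym (m≤n⇒∣n-m∣≡n∸m y≤x))
                     (reverse G (ascendingWalk _ y x (m+[n∸m]≡n y≤x)))

module Product (G H : Graph) where

  private
    B = Box G H

  π₁ : Fin (n G * n H) → Fin (n G)
  π₁ x = proj₁ (remQuot {n G} (n H) x)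

  π₂ : Fin (n G * n H) → Fin (n H)
  π₂ x = proj₂ (remQuot {n G} (n H) x)

  π₁-combine : ∀ a b → π₁ (combine a b) ≡ a
  π₁-combine a b = cong proj₁ (Finₚ.remQuot-combine {n G} {n H} a b)

  π₂-combine : ∀ a b → π₂ (combine a b) ≡ b
  π₂-combine a b = cong proj₂ (Finₚ.remQuot-combine {n G} {n H} a b)

  combine-π : ∀ x → combine (π₁ x) (π₂ x) ≡ x
  combine-π = Finₚ.combine-remQuot {n G} (n H)

  combineWalk : ∀ {a a′ b b′ k l} → Walk (Adj G) a a′ k → Walk (Adj H) b b′ l →
                Walk B (combine a b) (combine a′ b′) (k + l)
  combineWalk {a} {b = b} (g ∷ p) q = inj₂ (trans (π₂-combine a b) (sym (π₂-combine _ b)) ,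
    subst₂ (Adj G) (sym (π₁-combine a b)) (sym (π₁-combine _ b)) g) ∷ combineWalk p q
  combineWalk {a} {b = b} [] (h ∷ q) = inj₁ (trans (π₁-combine a b) (sym (π₁-combine a _)) ,
    subst₂ (Adj H) (sym (π₂-combine a b)) (sym (π₂-combine a _)) h) ∷ combineWalk [] q
  combineWalk [] [] = []

  walkOfProjections : ∀ {x y k l} → Walk (Adj G) (π₁ x) (π₁ y) k → Walk (Adj H) (π₂ x) (π₂ y) l →
                      Walk B x y (k + l)
  walkOfProjections {x} {y} p q =
    subst₂ (λ u v → Walk B u v _) (combine-π x) (combine-π y) (combineWalk p q)

  projectWalk : ∀ {x y k} → Walk B x y k → Σ ℕ λ k₁ → Σ ℕ λ k₂ → k₁ + k₂ ≡ k ×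
                Walk (Adj G) (π₁ x) (π₁ y) k₁ × Walk (Adj H) (π₂ x) (π₂ y) k₂
  projectWalk [] = 0 , 0 , refl , [] , []
  projectWalk (inj₁ (eq , h) ∷ p) with projectWalk p
  ... | k₁ , k₂ , refl , p₁ , p₂ =
    k₁ , suc k₂ , +-suc k₁ k₂ , subst (λ a → Walk (Adj G) a _ k₁) (sym eq) p₁ , h ∷ p₂
  projectWalk (inj₂ (eq , g) ∷ p) with projectWalk p
  ... | k₁ , k₂ , refl , p₁ , p₂ =
    suc k₁ , k₂ , refl , g ∷ p₁ , subst (λ b → Walk (Adj H) b _ k₂) (sym eq) p₂

  -- Both halves of a geodesic through z project to walks; if either projected pair
  -- could be shortened, recombining would shorten the geodesic.
  between-project : ∀ {x y z} → Between B x y z →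
    Between (Adj G) (π₁ x) (π₁ y) (π₁ z) × Between (Adj H) (π₂ x) (π₂ y) (π₂ z)
  between-project (between p q geodesic) with projectWalk p | projectWalk q
  ... | a₁ , b₁ , refl , p₁ , p₂ | a₂ , b₂ , refl , q₁ , q₂ =
      between p₁ q₁ (λ {m} r → +-cancelʳ-≤ (b₁ + b₂) (a₁ + a₂) m
                      (subst (_≤ m + (b₁ + b₂)) split (geodesic (walkOfProjections r (p₂ ++ q₂)))))
    , between p₂ q₂ (λ {m} r → +-cancelˡ-≤ (a₁ + a₂) (b₁ + b₂) m
                      (subst (_≤ (a₁ + a₂) + m) split (geodesic (walkOfProjections (p₁ ++ q₁) r))))
    where
      split : (a₁ + b₁) + (a₂ + b₂) ≡ (a₁ + a₂) + (b₁ + b₂)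
      split = interchange a₁ b₁ a₂ b₂

  interval-combine : ∀ {a a′ b b′ w} → InInterval B (combine a b) w (combine a′ b′) →
    InInterval (Adj G) a (π₁ w) a′ × InInterval (Adj H) b (π₂ w) b′
  interval-combine {a} {a′} {b} {b′} {w} I with between-project (interval⇒between I)
  ... | I₁ , I₂ =
      between⇒interval (subst₂ (λ u v → Between (Adj G) u (π₁ w) v) (π₁-combine a b) (π₁-combine a′ b′) I₁)
    , between⇒interval (subst₂ (λ u v → Between (Adj H) u (π₂ w) v) (π₂-combine a b) (π₂-combine a′ b′) I₂)

-- All that the size-two analysis uses about G □ H; abstracting it lets that analysis
-- run a second time with the two factors exchanged.
record IntervalProduct {N : ℕ} (B : AdjRel N) (G₁ G₂ : Graph) : Set where
  field
    pair           : Fin (n G₁) → Fin (n G₂) → Fin N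
    π₁             : Fin N → Fin (n G₁)
    π₂             : Fin N → Fin (n G₂)
    pair-injective : ∀ {a a′ b b′} → pair a b ≡ pair a′ b′ → a ≡ a′ × b ≡ b′
    interval-pair  : ∀ {a a′ b b′ w} → InInterval B (pair a b) w (pair a′ b′) →
                     InInterval (Adj G₁) a (π₁ w) a′ × InInterval (Adj G₂) b (π₂ w) b′

boxIntervalProduct : (G H : Graph) → IntervalProduct (Box G H) G H
boxIntervalProduct G H = record
  { pair           = combine
  ; π₁             = π₁
  ; π₂             = π₂
  ; pair-injective = Finₚ.combine-injective _ _ _ _
  ; interval-pair  = interval-combine
  }
  where open Product G H

swapFactors : ∀ {N} {B : AdjRel N} {G₁ G₂} → IntervalProduct B G₁ G₂ → IntervalProduct B G₂ G₁
swapFactors P = record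
  { pair           = flip pair
  ; π₁             = π₂
  ; π₂             = π₁
  ; pair-injective = Σ.swap ∘ pair-injective
  ; interval-pair  = Σ.swap ∘ interval-pair
  }
  where open IntervalProduct P

module _ {N : ℕ} {B : AdjRel N} {G₁ G₂ : Graph} (P : IntervalProduct B G₁ G₂)
         (2≤n₁ : 2 ≤ n G₁) (2≤n₂ : 2 ≤ n G₂) where

  open IntervalProduct P

  crossPair-unresolved : ∀ {w a b} → a ≢ π₁ w → b ≢ π₂ w →
                         ¬ StronglyResolves B w (pair a (π₂ w)) (pair (π₁ w) b)
  crossPair-unresolved a≢ b≢ (inj₁ I) = b≢ (interval-self (proj₂ (interval-pair I)))
  crossPair-unresolved a≢ b≢ (inj₂ I) = a≢ (interval-self (proj₁ (interval-pair I)))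

  pair-≢ˡ : ∀ {a a′ b b′} → a ≢ a′ → pair a b ≢ pair a′ b′
  pair-≢ˡ a≢a′ = a≢a′ ∘ proj₁ ∘ pair-injective

  strongResolvingSet-nonempty : ∀ {S} → IsStrongResolvingSet B S → Σ (Fin N) (_∈ S)
  strongResolvingSet-nonempty resolving =
    let a = aVertex 2≤n₁
        b = aVertex 2≤n₂
        a′ , a′≢a = anotherVertex 2≤n₁ a
        w , w∈S , _ = resolving (pair a′ b) (pair a b) (pair-≢ˡ a′≢a)
    in w , w∈S

  strongResolvingSet⇒2≤∣∣ : ∀ {S} → IsStrongResolvingSet B S → 2 ≤ ∣ S ∣
  strongResolvingSet⇒2≤∣∣ {S} resolving with ∣ S ∣ ≤? 1
  ... | no ∣S∣≰1 = ≰⇒> ∣S∣≰1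
  ... | yes ∣S∣≤1 with strongResolvingSet-nonempty resolving
  ... | w , w∈S with anotherVertex 2≤n₁ (π₁ w) | anotherVertex 2≤n₂ (π₂ w)
  ... | a , a≢ | b , b≢ with resolving (pair a (π₂ w)) (pair (π₁ w) b) (pair-≢ˡ a≢)
  ... | w′ , w′∈S , resolves rewrite ∣p∣≤1⇒∈-unique ∣S∣≤1 w′∈S w∈S =
    ⊥-elim (crossPair-unresolved a≢ b≢ resolves)

  module CommonFirstCoordinate {S} (resolving : IsStrongResolvingSet B S)
           {a} (π₁≡a : ∀ {w} → w ∈ S → π₁ w ≡ a) where

    firstInterval : ∀ {w u v b b′} → w ∈ S → InInterval B (pair u b) w (pair v b′) →
                    InInterval (Adj G₁) u a v
    firstInterval w∈S = subst (λ c → InInterval (Adj G₁) _ c _) (π₁≡a w∈S) ∘ proj₁ ∘ interval-pair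

    resolvesFirstFactor : ∀ x y → x ≢ y → StronglyResolves (Adj G₁) a x y
    resolvesFirstFactor x y x≢y
      with resolving (pair x (aVertex 2≤n₂)) (pair y (aVertex 2≤n₂)) (pair-≢ˡ x≢y)
    ... | w , w∈S , resolves = Sum.map (firstInterval w∈S) (firstInterval w∈S) resolves

    secondFactorCovered : ∀ b b′ → Σ (Fin N) λ w → w ∈ S × InInterval (Adj G₂) b′ (π₂ w) b
    secondFactorCovered b b′ with anotherVertex 2≤n₁ a
    ... | a′ , a′≢a with resolving (pair a b) (pair a′ b′) (pair-≢ˡ (≢-sym a′≢a))
    ... | w , w∈S , inj₁ I = contradiction (interval-self (firstInterval w∈S I)) a′≢a
    ... | w , w∈S , inj₂ I = w , w∈S , proj₂ (interval-pair I)

  commonFirstCoordinate⇒paths : ∀ {S} → IsStrongResolvingSet B S →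
    ∀ {w₁ w₂} → (∀ {w} → w ∈ S → w ≡ w₁ ⊎ w ≡ w₂) → π₁ w₁ ≡ π₁ w₂ → IsPath G₁ × IsPath G₂
  commonFirstCoordinate⇒paths resolving {w₁} {w₂} S⊆ π₁w₁≡π₁w₂ =
      SingleStrongResolver.isPath G₁ (π₁ w₁) resolvesFirstFactor
    , SingleStrongResolver.isPath G₂ (π₂ w₁) (twoCentres⇒resolves covered)
    where
      π₁≡π₁w₁ : ∀ {w} → w ∈ _ → π₁ w ≡ π₁ w₁
      π₁≡π₁w₁ w∈S with S⊆ w∈S
      ... | inj₁ refl = refl
      ... | inj₂ refl = sym π₁w₁≡π₁w₂
      open CommonFirstCoordinate resolving π₁≡π₁w₁
      covered : ∀ x y → x ≢ y → InInterval (Adj G₂) y (π₂ w₁) x ⊎ InInterval (Adj G₂) y (π₂ w₂) x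
      covered x y _ with secondFactorCovered x y
      ... | w , w∈S , I with S⊆ w∈S
      ... | inj₁ refl = inj₁ I
      ... | inj₂ refl = inj₂ I

  resolvers-shareCoordinate : ∀ {S} → IsStrongResolvingSet B S →
    ∀ {w₁ w₂} → (∀ {w} → w ∈ S → w ≡ w₁ ⊎ w ≡ w₂) → π₁ w₁ ≡ π₁ w₂ ⊎ π₂ w₁ ≡ π₂ w₂
  resolvers-shareCoordinate resolving {w₁} {w₂} S⊆ with π₁ w₁ Finₚ.≟ π₁ w₂ | π₂ w₁ Finₚ.≟ π₂ w₂
  ... | yes π₁≡ | _       = inj₁ π₁≡
  ... | no _    | yes π₂≡ = inj₂ π₂≡
  ... | no π₁≢  | no π₂≢
    with resolving (pair (π₁ w₂) (π₂ w₁)) (pair (π₁ w₁) (π₂ w₂)) (pair-≢ˡ (≢-sym π₁≢))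
  ... | w , w∈S , resolves with S⊆ w∈S
  ... | inj₁ refl = ⊥-elim (crossPair-unresolved (≢-sym π₁≢) (≢-sym π₂≢) resolves)
  ... | inj₂ refl = ⊥-elim (crossPair-unresolved π₁≢ π₂≢ (Sum.swap resolves))

strongResolvingSet≤2⇒paths : ∀ {N} {B : AdjRel N} {G₁ G₂} → IntervalProduct B G₁ G₂ →
  2 ≤ n G₁ → 2 ≤ n G₂ → ∀ {S} → IsStrongResolvingSet B S → ∣ S ∣ ≤ 2 → IsPath G₁ × IsPath G₂
strongResolvingSet≤2⇒paths P 2≤n₁ 2≤n₂ resolving ∣S∣≤2
  with strongResolvingSet-nonempty P 2≤n₁ 2≤n₂ resolving
... | w₁ , w₁∈S with ∣p∣≤2⇒⊆pair ∣S∣≤2 w₁∈S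
... | w₂ , S⊆ with resolvers-shareCoordinate P 2≤n₁ 2≤n₂ resolving S⊆
... | inj₁ π₁≡ = commonFirstCoordinate⇒paths P 2≤n₁ 2≤n₂ resolving S⊆ π₁≡
... | inj₂ π₂≡ = Σ.swap (commonFirstCoordinate⇒paths (swapFactors P) 2≤n₂ 2≤n₁ resolving S⊆ π₂≡)

module Grid (G H : Graph) (pathG : IsPath G) (pathH : IsPath H)
            (2≤nG : 2 ≤ n G) (2≤nH : 2 ≤ n H) where

  open Product G H

  private
    B = Box G H
    module X = PathCoordinate G pathG
    module Y = PathCoordinate H pathH

  X Y : Fin (n G * n H) → ℕ
  X x = X.coord (π₁ x)
  Y x = Y.coord (π₂ x)

  ℓ₁ : Fin (n G * n H) → Fin (n G * n H) → ℕ
  ℓ₁ x y = ∣ X x - X y ∣ + ∣ Y x - Y y ∣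

  ℓ₁≤walk : ∀ {x y k} → Walk B x y k → ℓ₁ x y ≤ k
  ℓ₁≤walk p with projectWalk p
  ... | _ , _ , refl , p₁ , p₂ = +-mono-≤ (X.walk-coord p₁) (Y.walk-coord p₂)

  ℓ₁-walk : ∀ x y → Walk B x y (ℓ₁ x y)
  ℓ₁-walk x y = walkOfProjections (X.coordWalk (π₁ x) (π₁ y)) (Y.coordWalk (π₂ x) (π₂ y))

  coordinatewiseBetween⇒interval : ∀ {u v w} →
    ∣ X v - X u ∣ + ∣ X u - X w ∣ ≡ ∣ X v - X w ∣ →
    ∣ Y v - Y u ∣ + ∣ Y u - Y w ∣ ≡ ∣ Y v - Y w ∣ → InInterval B v w u
  coordinatewiseBetween⇒interval {u} {v} {w} X-between Y-between =
    between⇒interval (between (ℓ₁-walk v u) (ℓ₁-walk u w) λ r →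
      ≤-trans (≤-reflexive additive) (ℓ₁≤walk r))
    where
      additive : ℓ₁ v u + ℓ₁ u w ≡ ℓ₁ v w
      additive = trans (interchange ∣ X v - X u ∣ ∣ Y v - Y u ∣ ∣ X u - X w ∣ ∣ Y u - Y w ∣)
                       (cong₂ _+_ X-between Y-between)

  private
    0<n : ∀ {m} → 2 ≤ m → 0 < m
    0<n = ≤-trans (s≤s z≤n)

    pred-nH<nH : pred (n H) < n H
    pred-nH<nH = m≤pred[n]⇒suc[m]≤n {{>-nonZero (0<n 2≤nH)}} ≤-refl

    g₀ = proj₁ (X.vertexAt (0<n 2≤nG))
    h₀ = proj₁ (Y.vertexAt (0<n 2≤nH))
    hₜ = proj₁ (Y.vertexAt pred-nH<nH)

  lowCorner highCorner : Fin (n G * n H)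
  lowCorner  = combine g₀ h₀
  highCorner = combine g₀ hₜ

  corners : Subset (n G * n H)
  corners = ⁅ lowCorner ⁆ ∪ ⁅ highCorner ⁆

  X-corner : ∀ h → X (combine g₀ h) ≡ 0
  X-corner h = trans (cong X.coord (π₁-combine g₀ h)) (proj₂ (X.vertexAt (0<n 2≤nG)))

  Y-lowCorner : Y lowCorner ≡ 0
  Y-lowCorner = trans (cong Y.coord (π₂-combine g₀ h₀)) (proj₂ (Y.vertexAt (0<n 2≤nH)))

  Y-highCorner : Y highCorner ≡ pred (n H)
  Y-highCorner = trans (cong Y.coord (π₂-combine g₀ hₜ)) (proj₂ (Y.vertexAt pred-nH<nH))

  -- With X u ≤ X v, the low corner lies below both coordinates of u when Y u ≤ Y v,
  -- and the high corner above Y u otherwise; either way u is coordinatewise between.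
  cornerBeyond : ∀ {u v} → X u ≤ X v → Σ (Fin (n G * n H)) λ w → w ∈ corners × InInterval B v w u
  cornerBeyond {u} {v} Xu≤Xv with ≤-total (Y u) (Y v)
  ... | inj₁ Yu≤Yv = lowCorner , x∈p∪q⁺ (inj₁ (x∈⁅x⁆ lowCorner)) , coordinatewiseBetween⇒interval
        (o≤n≤m⇒∣m-n∣+∣n-o∣≡∣m-o∣ (subst (_≤ X u) (sym (X-corner h₀)) z≤n) Xu≤Xv)
        (o≤n≤m⇒∣m-n∣+∣n-o∣≡∣m-o∣ (subst (_≤ Y u) (sym Y-lowCorner) z≤n) Yu≤Yv)
  ... | inj₂ Yv≤Yu = highCorner , x∈p∪q⁺ (inj₂ (x∈⁅x⁆ highCorner)) , coordinatewiseBetween⇒interval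
        (o≤n≤m⇒∣m-n∣+∣n-o∣≡∣m-o∣ (subst (_≤ X u) (sym (X-corner hₜ)) z≤n) Xu≤Xv)
        (m≤n≤o⇒∣m-n∣+∣n-o∣≡∣m-o∣ Yv≤Yu (subst (Y u ≤_) (sym Y-highCorner) (<⇒≤pred (Finₚ.toℕ<n _))))

  corners-resolving : IsStrongResolvingSet B corners
  corners-resolving u v _ with ≤-total (X u) (X v)
  ... | inj₁ Xu≤Xv = Σ.map₂ (Σ.map₂ inj₂) (cornerBeyond Xu≤Xv)
  ... | inj₂ Xv≤Xu = Σ.map₂ (Σ.map₂ inj₁) (cornerBeyond Xv≤Xu)

  ∣corners∣≡2 : ∣ corners ∣ ≡ 2
  ∣corners∣≡2 = ∣⁅x⁆∪⁅y⁆∣≡2 λ low≡high →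
    <⇒≢ (pred-mono-≤ 2≤nH) (trans (sym Y-lowCorner) (trans (cong Y low≡high) Y-highCorner))

  strongMetricDim≡2 : StrongMetricDimIs B 2
  strongMetricDim≡2 = (corners , corners-resolving , ∣corners∣≡2) ,
    λ _ → strongResolvingSet⇒2≤∣∣ (boxIntervalProduct G H) 2≤nG 2≤nH

-- The connectivity hypotheses are unused: strong resolution itself provides the
-- walks the forward direction needs, and paths are connected.
proposition29 : (G H : Graph) → Connected (Adj G) → Connected (Adj H) →
    2 ≤ n G → 2 ≤ n H →
    (StrongMetricDimIs (Box G H) 2 ⇔ (IsPath G × IsPath H))
proposition29 G H _ _ 2≤nG 2≤nH = mk⇔
  (λ ((S , resolving , ∣S∣≡2) , _) →
     strongResolvingSet≤2⇒paths (boxIntervalProduct G H) 2≤nG 2≤nH resolving (≤-reflexive ∣S∣≡2))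
  (λ (pathG , pathH) → Grid.strongMetricDim≡2 G H pathG pathH 2≤nG 2≤nH)
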